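{- Let $k\ge 1$ and let $n$ be an integer. Then $n \in I_k$ if and only if $2^k-n \in I_k$.
   Context: A BSD representation of an integer is a digit string $(b_{m-1}\cdots b_0)$ with $b_j\in\{1,0,-1\}$ representing $\sum b_j2^j$. A non-adjacent form (NAF) is a BSD representation in which no two adjacent digits are both nonzero; it is reduced if its leading digit is nonzero. Every positive integer has exactly one reduced NAF; its length is the NAF-bitlength. $I_k$ denotes the set of positive integers of NAF-bitlength $k$. -}

module Defs where

open import Data.Nat using (ℕ)
open import Data.Integer using (ℤ; +_; -[1+_]; _+_; _*_; _>_)
open import Data.List using (List; []; _∷_; length)
open import Data.Product using (Σ; _×_)
open import Relation.Binary.PropositionalEquality using (_≡_)
open import Data.Empty using (⊥)
open import Data.Unit using (⊤)

data Digit : Set where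
  d1 d0 dm1 : Digit

digitVal : Digit → ℤ
digitVal d1  = + 1
digitVal d0  = + 0
digitVal dm1 = -[1+ 0 ]

NonZeroDigit : Digit → Set
NonZeroDigit d0 = ⊥
NonZeroDigit _  = ⊤

-- A BSD representation (b_{m-1} ... b_0) is stored least significant digit
-- first: the list b_0 ∷ b_1 ∷ ... ∷ b_{m-1} ∷ [].
BSD : Set
BSD = List Digit

value : BSD → ℤ
value []       = + 0
value (b ∷ bs) = digitVal b + (+ 2) * value bs

IsNAF : BSD → Set
IsNAF []           = ⊤
IsNAF (b ∷ [])     = ⊤
IsNAF (b ∷ c ∷ bs) = (NonZeroDigit b → NonZeroDigit c → ⊥) × IsNAF (c ∷ bs)

LeadingNonZero : BSD → Set
LeadingNonZero []           = ⊥
LeadingNonZero (b ∷ [])     = NonZeroDigit b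
LeadingNonZero (b ∷ c ∷ bs) = LeadingNonZero (c ∷ bs)

ReducedNAF : BSD → Set
ReducedNAF bs = IsNAF bs × LeadingNonZero bs

-- n ∈ I_k : n is a positive integer whose (unique) reduced NAF has length k.
-- Since the reduced NAF of a positive integer is unique, this is the same as
-- the existence of a reduced NAF of length k representing n.
InI : ℕ → ℤ → Set
InI k n = (n > + 0) × Σ BSD (λ bs → ReducedNAF bs × length bs ≡ k × value bs ≡ n)

{-# OPTIONS --safe #-}
-- If n has reduced NAF b_{k-1} ⋯ b_0 with n > 0, its leading digit is 1 (a
-- leading -1 would make the value negative). Negating every digit below the
-- top one and keeping the top digit 1 gives a reduced NAF of the same length
-- with the same nonzero positions, and the two values add up to
-- 2·2^{k-1} = 2^k. Since n ↦ 2^k - n is an involution, one direction suffices.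
module Submission where

open import Defs
open import Data.Nat using (ℕ; _≥_; _^_)
open import Data.Integer using (ℤ; +_; _-_)
open import Function.Bundles using (_⇔_)

import Data.Nat as ℕ
import Data.Nat.Properties as ℕ
open import Data.Integer using (-[1+_]; +[1+_]; _+_; _*_; _<_; _>_; +<+; -<+)
open import Data.Integer.Properties using (<-asym; pos-*; +-identityˡ)
open import Data.Integer.Tactic.RingSolver using (solve-∀)
open import Data.List using ([]; _∷_; length)
open import Data.Product using (_,_)
open import Data.Empty using (⊥-elim)
open import Data.Unit using (tt)
open import Function.Bundles using (mk⇔)
open import Relation.Binary.PropositionalEquality
  using (_≡_; refl; cong; cong₂; subst)
open Relation.Binary.PropositionalEquality.≡-Reasoning

negateDigit : Digit → Digit
negateDigit d1  = dm1
negateDigit d0  = d0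
negateDigit dm1 = d1

digitVal-negateDigit : (d : Digit) → digitVal d + digitVal (negateDigit d) ≡ + 0
digitVal-negateDigit d1  = refl
digitVal-negateDigit d0  = refl
digitVal-negateDigit dm1 = refl

nonZero-negateDigit⁻ : (d : Digit) → NonZeroDigit (negateDigit d) → NonZeroDigit d
nonZero-negateDigit⁻ d1  _ = tt
nonZero-negateDigit⁻ dm1 _ = tt

-- Defaults to d0 on the empty representation.
leadingDigit : BSD → Digit
leadingDigit []           = d0
leadingDigit (b ∷ [])     = b
leadingDigit (b ∷ c ∷ bs) = leadingDigit (c ∷ bs)

leadingNonZero⇒nonZero-leadingDigit :
  (bs : BSD) → LeadingNonZero bs → NonZeroDigit (leadingDigit bs)
leadingNonZero⇒nonZero-leadingDigit (b ∷ [])     h = h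
leadingNonZero⇒nonZero-leadingDigit (b ∷ c ∷ bs) h =
  leadingNonZero⇒nonZero-leadingDigit (c ∷ bs) h

digit+2*-pos : (d : Digit) (v : ℤ) → v > + 0 → digitVal d + + 2 * v > + 0
digit+2*-pos d   (+ ℕ.zero) (+<+ ())
digit+2*-pos d1  +[1+ m ]   _ = +<+ (ℕ.s≤s ℕ.z≤n)
digit+2*-pos d0  +[1+ m ]   _ = +<+ (ℕ.s≤s ℕ.z≤n)
digit+2*-pos dm1 +[1+ m ]   _ rewrite ℕ.+-suc m (m ℕ.+ 0) = +<+ (ℕ.s≤s ℕ.z≤n)

digit+2*-neg : (d : Digit) (v : ℤ) → v < + 0 → digitVal d + + 2 * v < + 0
digit+2*-neg d   (+ n)    (+<+ ())
digit+2*-neg d1  -[1+ m ] _ rewrite ℕ.+-suc m (m ℕ.+ 0) = -<+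
digit+2*-neg d0  -[1+ m ] _ = -<+
digit+2*-neg dm1 -[1+ m ] _ = -<+

value-pos : (bs : BSD) → leadingDigit bs ≡ d1 → value bs > + 0
value-pos (d1 ∷ [])    refl = +<+ (ℕ.s≤s ℕ.z≤n)
value-pos (b ∷ c ∷ bs) e    = digit+2*-pos b _ (value-pos (c ∷ bs) e)

value-neg : (bs : BSD) → leadingDigit bs ≡ dm1 → value bs < + 0
value-neg (dm1 ∷ [])   refl = -<+
value-neg (b ∷ c ∷ bs) e    = digit+2*-neg b _ (value-neg (c ∷ bs) e)

leadingDigit≡d1 : (bs : BSD) → LeadingNonZero bs → value bs > + 0 → leadingDigit bs ≡ d1
leadingDigit≡d1 bs lnz pos with leadingDigit bs in eq
... | d1  = refl
... | d0  = ⊥-elim (subst NonZeroDigit eq (leadingNonZero⇒nonZero-leadingDigit bs lnz))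
... | dm1 = ⊥-elim (<-asym (value-neg bs eq) pos)

complement : BSD → BSD
complement []           = []
complement (b ∷ [])     = d1 ∷ []
complement (b ∷ c ∷ bs) = negateDigit b ∷ complement (c ∷ bs)

length-complement : (bs : BSD) → length (complement bs) ≡ length bs
length-complement []           = refl
length-complement (b ∷ [])     = refl
length-complement (b ∷ c ∷ bs) = cong ℕ.suc (length-complement (c ∷ bs))

leadingDigit-complement : (b : Digit) (bs : BSD) → leadingDigit (complement (b ∷ bs)) ≡ d1
leadingDigit-complement b []           = refl
leadingDigit-complement b (c ∷ [])     = refl
leadingDigit-complement b (c ∷ d ∷ bs) = leadingDigit-complement c (d ∷ bs)

leadingNonZero-complement : (b : Digit) (bs : BSD) → LeadingNonZero (complement (b ∷ bs))
leadingNonZero-complement b []           = tt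
leadingNonZero-complement b (c ∷ [])     = tt
leadingNonZero-complement b (c ∷ d ∷ bs) = leadingNonZero-complement c (d ∷ bs)

isNAF-complement : (bs : BSD) → IsNAF bs → LeadingNonZero bs → IsNAF (complement bs)
isNAF-complement []               _           _   = tt
isNAF-complement (b ∷ [])         _           _   = tt
isNAF-complement (b ∷ c ∷ [])     (nab , _)   lnz =
  (λ nb _ → nab (nonZero-negateDigit⁻ b nb) lnz) , tt
isNAF-complement (b ∷ c ∷ d ∷ bs) (nab , naf) lnz =
  (λ nb nc → nab (nonZero-negateDigit⁻ b nb) (nonZero-negateDigit⁻ c nc))
  , isNAF-complement (c ∷ d ∷ bs) naf lnz

reducedNAF-complement : (bs : BSD) → ReducedNAF bs → ReducedNAF (complement bs)
reducedNAF-complement (b ∷ bs) (naf , lnz) =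
  isNAF-complement (b ∷ bs) naf lnz , leadingNonZero-complement b bs

value-+-complement :
  (bs : BSD) → leadingDigit bs ≡ d1 → value bs + value (complement bs) ≡ + (2 ^ length bs)
value-+-complement (d1 ∷ [])        refl = refl
value-+-complement (b ∷ cs@(_ ∷ _)) e    = begin
  (digitVal b + + 2 * value cs) + (digitVal (negateDigit b) + + 2 * value (complement cs))
    ≡⟨ interchange (digitVal b) _ (value cs) _ ⟩
  (digitVal b + digitVal (negateDigit b)) + + 2 * (value cs + value (complement cs))
    ≡⟨ cong₂ (λ x y → x + + 2 * y) (digitVal-negateDigit b) (value-+-complement cs e) ⟩
  + 0 + + 2 * + (2 ^ length cs)
    ≡⟨ +-identityˡ _ ⟩
  + 2 * + (2 ^ length cs)
    ≡⟨ pos-* 2 (2 ^ length cs) ⟨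
  + (2 ^ length (b ∷ cs)) ∎
  where
  interchange : ∀ a b v w → (a + + 2 * v) + (b + + 2 * w) ≡ (a + b) + + 2 * (v + w)
  interchange = solve-∀

value-complement :
  (bs : BSD) → leadingDigit bs ≡ d1 → value (complement bs) ≡ + (2 ^ length bs) - value bs
value-complement bs e = begin
  value (complement bs)                          ≡⟨ cancel (value bs) _ ⟩
  (value bs + value (complement bs)) - value bs  ≡⟨ cong (_- value bs) (value-+-complement bs e) ⟩
  + (2 ^ length bs) - value bs                   ∎
  where
  cancel : ∀ v w → w ≡ (v + w) - v
  cancel = solve-∀

InI-2^k- : (k : ℕ) (n : ℤ) → InI k n → InI k (+ (2 ^ k) - n)
InI-2^k- k n (pos , bs@(b ∷ bs′) , rnaf@(_ , lnz) , refl , refl) =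
  subst (_> + 0) value≡ (value-pos (complement bs) (leadingDigit-complement b bs′))
  , complement bs , reducedNAF-complement bs rnaf , length-complement bs , value≡
  where
  value≡ : value (complement bs) ≡ + (2 ^ length bs) - value bs
  value≡ = value-complement bs (leadingDigit≡d1 bs lnz pos)

mainTheorem9 : (k : ℕ) → k ≥ 1 → (n : ℤ) → InI k n ⇔ InI k ((+ (2 ^ k)) - n)
mainTheorem9 k _ n = mk⇔ (InI-2^k- k n) (λ h → subst (InI k) (involutive (+ (2 ^ k)) n) (InI-2^k- k _ h))
  where
  involutive : ∀ a n → a - (a - n) ≡ n
  involutive = solve-∀
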